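{- Let $r\geq 1$ be an integer, let $G$ be a graph, let $\mathcal{X}$ be a set of connected subgraphs of $G$, and let $H$ be the intersection graph of $\mathcal{X}$. If $H$ contains $K_\ell$ as a minor and $H$ contains no subgraph isomorphic to $K_{r+1}$, then the treewidth of $G$ is at least $\lceil \ell/r\rceil-1$.
   Context: All graphs are finite, simple and undirected. The intersection graph of a set $\mathcal{X}$ of subgraphs of $G$ is the graph with vertex set $\mathcal{X}$ in which two distinct members are adjacent if and only if they share a vertex. -}

module Defs where

open import Level using (0ℓ)
open import Data.Nat using (ℕ; zero; suc; _+_; _∸_; _≤_; _/_; >-nonZero)

open import Data.Fin using (Fin; zero; suc; inject₁; fromℕ)
open import Data.Fin.Subset using (Subset; _∈_; ∣_∣)
open import Data.Vec using (Vec; lookup)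
open import Data.Integer as ℤ using (ℤ; +_; 1ℤ)
open import Data.Product using (Σ; ∃; ∃-syntax; _×_; _,_; proj₁; proj₂)
open import Data.Empty using (⊥)
open import Relation.Nullary using (¬_)
open import Relation.Binary.PropositionalEquality using (_≡_; _≢_)
open import Function.Definitions using (Injective)

record Graph : Set₁ where
  field
    n      : ℕ
    Adj    : Fin n → Fin n → Set
    sym    : ∀ {u v} → Adj u v → Adj v u
    irrefl : ∀ {u} → ¬ Adj u u
open Graph public

data PathIn {A : Set} (R : A → A → Set) (P : A → Set) : A → A → Set where
  here : ∀ {x} → P x → PathIn R P x x
  step : ∀ {x y z} → P x → R x y → PathIn R P y z → PathIn R P x z

Connected : {A : Set} → (A → A → Set) → (A → Set) → Set
Connected {A} R P = (∃[ x ] P x) × (∀ x y → P x → P y → PathIn R P x y)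

HasCycle : Graph → Set
HasCycle G = ∃[ k ] Σ (Fin (suc (suc (suc k))) → Fin (n G)) λ c →
    Injective _≡_ _≡_ c
  × (∀ (i : Fin (suc (suc k))) → Adj G (c (inject₁ i)) (c (suc i)))
  × Adj G (c (fromℕ (suc (suc k)))) (c zero)

IsTree : Graph → Set
IsTree T = Connected (Adj T) (λ _ → Data.Unit.⊤) × ¬ HasCycle T
  where import Data.Unit

-- Subgraph data: a vertex set and an edge set (edge uv present iff v ∈ E[u]).
SubgraphData : ℕ → Set
SubgraphData m = Subset m × Vec (Subset m) m

IsSubgraph : (G : Graph) → SubgraphData (n G) → Set
IsSubgraph G (V , E) =
    (∀ u v → v ∈ lookup E u → Adj G u v × u ∈ V × v ∈ V)
  × (∀ u v → v ∈ lookup E u → u ∈ lookup E v)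

IsConnectedSubgraph : (G : Graph) → SubgraphData (n G) → Set
IsConnectedSubgraph G S@(V , E) =
  IsSubgraph G S × Connected (λ u v → v ∈ lookup E u) (λ v → v ∈ V)

IntersectionGraph : (G : Graph) {m : ℕ} → (Fin m → SubgraphData (n G)) → Graph
IntersectionGraph G {m} X = record
  { n = m
  ; Adj = λ i j → i ≢ j × ∃[ v ] (v ∈ proj₁ (X i) × v ∈ proj₁ (X j))
  ; sym = λ { (i≢j , v , a , b) → (λ eq → i≢j (Relation.Binary.PropositionalEquality.sym eq)) , v , b , a }
  ; irrefl = λ { (i≢i , _) → i≢i Relation.Binary.PropositionalEquality.refl }
  }

HasCliqueMinor : Graph → ℕ → Set
HasCliqueMinor H ℓ = Σ (Fin ℓ → Subset (n H)) λ B →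
    (∀ i → Connected (Adj H) (λ x → x ∈ B i))
  × (∀ i j → i ≢ j → ∀ x → x ∈ B i → x ∈ B j → ⊥)
  × (∀ i j → i ≢ j → ∃[ x ] ∃[ y ] (x ∈ B i × y ∈ B j × Adj H x y))

HasCliqueSubgraph : Graph → ℕ → Set
HasCliqueSubgraph H k = Σ (Fin k → Fin (n H)) λ f →
  Injective _≡_ _≡_ f × (∀ i j → i ≢ j → Adj H (f i) (f j))

IsTreeDecomposition : (G T : Graph) → (Fin (n T) → Subset (n G)) → Set
IsTreeDecomposition G T β =
    IsTree T
  × (∀ v → ∃[ x ] v ∈ β x)
  × (∀ u v → Adj G u v → ∃[ x ] (u ∈ β x × v ∈ β x))
  × (∀ v → Connected (Adj T) (λ x → v ∈ β x))

TreewidthAtLeast : Graph → ℤ → Set₁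
TreewidthAtLeast G k = ∀ (T : Graph) (β : Fin (n T) → Subset (n G)) →
  IsTreeDecomposition G T β → ∃[ x ] (k ℤ.≤ (+ ∣ β x ∣) ℤ.- 1ℤ)

ceilDiv : (a r : ℕ) → 1 ≤ r → ℕ
ceilDiv a r p = _/_ (a + r ∸ 1) r {{>-nonZero p}}

module Submission where

-- Let (T , β) be a tree decomposition of G and B₁ … B_ℓ the branch sets of a
-- K_ℓ-model in the intersection graph H of X.  For every i the bags meeting a
-- member of B_i form a connected subgraph S_i of T (members of X are connected
-- in G, B_i is connected in H), and any two S_i , S_j share a bag, because some
-- member of B_i meets some member of B_j.  By the Helly property of subtrees of
-- a tree one bag β x meets every branch set; pick for each i a vertex h i ∈ β x
-- of a member of B_i.  Members of different branch sets are different, so r + 1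
-- indices in one fibre of h would span K_{r+1} in H.  Hence every fibre of h has
-- at most r elements, ℓ ≤ r · |β x|, and β x has at least ⌈ℓ/r⌉ vertices.

open import Defs hiding (sym; irrefl)
open import Data.Nat using (ℕ; zero; suc; _+_; _*_; _∸_; _≤_; _<_; z≤n; s≤s; _≤?_; _<?_)
open import Data.Nat.Properties
open import Data.Nat.Induction using (<-rec)
open import Data.Nat.DivMod using (m<n*o⇒m/o<n)
open import Data.Fin as Fin using (Fin; zero; suc; toℕ; inject₁; fromℕ)
open import Data.Fin.Properties
  using (toℕ-injective; toℕ-inject₁; toℕ-fromℕ; toℕ<n; toℕ≤pred[n]; any?; all?; ¬∀⟶∃¬; pigeonhole)
open import Data.Fin.Subset using (Subset; _∈_; ∣_∣) renaming (_-_ to _⊖_)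
open import Data.Fin.Subset.Properties using (_∈?_; x∈p∧x≢y⇒x∈p-y; x∈p⇒∣p-x∣<∣p∣)
open import Data.List using (List; []; _∷_; length; allFin)
open import Data.List.Properties using (length-tabulate)
import Data.List.Membership.Propositional as List
open import Data.List.Relation.Unary.Any using (here; there)
open import Data.List.Relation.Unary.All as All using (All; []; _∷_)
open import Data.List.Relation.Unary.AllPairs using ([]; _∷_)
open import Data.List.Relation.Unary.Unique.Propositional using (Unique)
open import Data.List.Relation.Unary.Unique.Propositional.Properties using (allFin⁺)
open import Data.Vec using (lookup)
open import Data.Integer as ℤ using (+_; _-_; 1ℤ)
import Data.Integer.Properties as ℤ
open import Data.Product using (Σ; ∃; ∃₂; ∃-syntax; _×_; _,_; proj₁; proj₂)
open import Data.Sum using (_⊎_; inj₁; inj₂)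
open import Data.Empty using (⊥; ⊥-elim)
open import Data.Unit using (⊤; tt)
open import Relation.Nullary using (¬_; Dec; yes; no)
open import Relation.Nullary.Decidable using (_×-dec_; map′)
open import Relation.Binary.Definitions using (DecidableEquality; tri<; tri≈; tri>)
open import Relation.Binary.PropositionalEquality
open import Function.Base using (_∘_; id)
open import Function.Definitions using (Injective)

module _ {A : Set} {R : A → A → Set} {P : A → Set} where

  headₚ : ∀ {x y} → PathIn R P x y → P x
  headₚ (here p)     = p
  headₚ (step p _ _) = p

  infixr 5 _++ₚ_

  _++ₚ_ : ∀ {x y z} → PathIn R P x y → PathIn R P y z → PathIn R P x z
  here _     ++ₚ w′ = w′
  step p r w ++ₚ w′ = step p r (w ++ₚ w′)

  reverseₚ : (∀ {a b} → R a b → R b a) → ∀ {x y} → PathIn R P x y → PathIn R P y x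
  reverseₚ sym (here p)     = here p
  reverseₚ sym (step p r w) = reverseₚ sym w ++ₚ step (headₚ w) (sym r) (here p)

  -- The number of steps of a walk and its j-th vertex (its end for j ≥ steps).
  steps : ∀ {x y} → PathIn R P x y → ℕ
  steps (here _)     = 0
  steps (step _ _ w) = suc (steps w)

  vertexAt : ∀ {x y} → PathIn R P x y → ℕ → A
  vertexAt {x} (here _)     _       = x
  vertexAt {x} (step _ _ w) zero    = x
  vertexAt     (step _ _ w) (suc j) = vertexAt w j

  vertexAt-first : ∀ {x y} (w : PathIn R P x y) → vertexAt w 0 ≡ x
  vertexAt-first (here _)     = refl
  vertexAt-first (step _ _ _) = refl

  vertexAt-last : ∀ {x y} (w : PathIn R P x y) → vertexAt w (steps w) ≡ y
  vertexAt-last (here _)     = refl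
  vertexAt-last (step _ _ w) = vertexAt-last w

  vertexAt-step : ∀ {x y} (w : PathIn R P x y) j → j < steps w
                → R (vertexAt w j) (vertexAt w (suc j))
  vertexAt-step (step _ r (here _))       zero    _         = r
  vertexAt-step (step _ r (step _ _ _))   zero    _         = r
  vertexAt-step (step _ _ w)              (suc j) (s≤s j<n) = vertexAt-step w j j<n

mapₚ : ∀ {A : Set} {R R′ : A → A → Set} {P Q : A → Set}
     → (∀ {a} → P a → Q a) → (∀ {a b} → P a → P b → R a b → R′ a b)
     → ∀ {x y} → PathIn R P x y → PathIn R′ Q x y
mapₚ f g (here p)     = here (f p)
mapₚ f g (step p r w) = step (f p) (g p (headₚ w) r) (mapₚ f g w)

lastDeparture : ∀ {A : Set} {R : A → A → Set} → DecidableEquality A → (t : A) → ∀ {x s}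
  → PathIn R (λ _ → ⊤) x s → s ≢ t
  → PathIn R (_≢ t) x s ⊎ ∃[ u ] (R t u × PathIn R (_≢ t) u s)
lastDeparture _≟_ t (here _) s≢t = inj₁ (here s≢t)
lastDeparture _≟_ t (step {x} _ r w) s≢t with lastDeparture _≟_ t w s≢t
... | inj₂ departure = inj₂ departure
... | inj₁ avoiding with x ≟ t
...   | yes refl = inj₂ (_ , r , avoiding)
...   | no x≢t   = inj₁ (step x≢t r avoiding)

module NonBacktracking (T : Graph) (w : ℕ → Fin (n T)) (L : ℕ)
  (adjacent : ∀ j → j < L → Adj T (w j) (w (suc j)))
  (noBacktrack : ∀ j → suc (suc j) ≤ L → w j ≢ w (suc (suc j))) where

  Repeats : ℕ → ℕ → Set
  Repeats d p = ∃₂ λ (a b : Fin d) → toℕ a < toℕ b × w (p + toℕ a) ≡ w (p + toℕ b)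

  repeats? : ∀ d p → Dec (Repeats d p)
  repeats? d p = any? λ a → any? λ b →
    (toℕ a <? toℕ b) ×-dec (w (p + toℕ a) Fin.≟ w (p + toℕ b))

  simpleSegment⇒cycle : ∀ k p → p + suc (suc (suc k)) ≤ L
    → w p ≡ w (p + suc (suc (suc k))) → ¬ Repeats (suc (suc (suc k))) p → HasCycle T
  simpleSegment⇒cycle k p end≤L closed simple = k , c , injective , consecutive , closing
    where
    c : Fin (suc (suc (suc k))) → Fin (n T)
    c i = w (p + toℕ i)

    injective : Injective _≡_ _≡_ c
    injective {i} {j} ci≡cj with <-cmp (toℕ i) (toℕ j)
    ... | tri< i<j _ _ = ⊥-elim (simple (i , j , i<j , ci≡cj))
    ... | tri≈ _ i≡j _ = toℕ-injective i≡j
    ... | tri> _ _ j<i = ⊥-elim (simple (j , i , j<i , sym ci≡cj))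

    step-from : ∀ i → i < suc (suc (suc k)) → Adj T (w (p + i)) (w (p + suc i))
    step-from i i<3+k = subst (λ q → Adj T (w (p + i)) (w q)) (sym (+-suc p i))
                              (adjacent (p + i) (≤-trans (+-monoʳ-< p i<3+k) end≤L))

    consecutive : ∀ (i : Fin (suc (suc k))) → Adj T (c (inject₁ i)) (c (suc i))
    consecutive i rewrite toℕ-inject₁ i = step-from (toℕ i) (m<n⇒m<1+n (toℕ<n i))

    closing : Adj T (c (fromℕ (suc (suc k)))) (c zero)
    closing rewrite toℕ-fromℕ (suc (suc k)) | +-identityʳ p =
      subst (Adj T (w (p + suc (suc k)))) (sym closed) (step-from (suc (suc k)) (n<1+n _))

  ClosedSegmentHasCycle : ℕ → Set
  ClosedSegmentHasCycle d = ∀ p → 0 < d → p + d ≤ L → w p ≡ w (p + d) → HasCycle T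

  -- Every closed segment contains a cycle: shorten it to a closed segment
  -- between two repeated vertices until none is left (strong induction on d).
  closedSegment⇒cycle : ∀ d → ClosedSegmentHasCycle d
  closedSegment⇒cycle = <-rec ClosedSegmentHasCycle shorten
    where
    shorten : ∀ d → (∀ {d′} → d′ < d → ClosedSegmentHasCycle d′) → ClosedSegmentHasCycle d
    shorten d shorter p 0<d end≤L closed with repeats? d p
    ... | yes (a , b , a<b , same) =
      shorter (≤-trans (s≤s (m∸n≤m (toℕ b) (toℕ a))) (toℕ<n b)) (p + toℕ a)
        (m<n⇒0<n∸m a<b)
        (subst (_≤ L) (sym inner-end) (≤-trans (+-monoʳ-≤ p (<⇒≤ (toℕ<n b))) end≤L))
        (trans same (cong w (sym inner-end)))
      where
      inner-end : p + toℕ a + (toℕ b ∸ toℕ a) ≡ p + toℕ b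
      inner-end = trans (+-assoc p (toℕ a) _) (cong (λ z → p + z) (m+[n∸m]≡n (<⇒≤ a<b)))
    ... | no simple = noRepeats d p 0<d end≤L closed simple
      where
      -- Segments of length 1 and 2 close up only through a loop or a backtrack.
      noRepeats : ∀ d p → 0 < d → p + d ≤ L → w p ≡ w (p + d) → ¬ Repeats d p → HasCycle T
      noRepeats (suc zero) p _ end≤L closed _ =
        ⊥-elim (Graph.irrefl T (subst (Adj T (w p)) (trans (cong w (+-comm 1 p)) (sym closed))
                                       (adjacent p (subst (_≤ L) (+-comm p 1) end≤L))))
      noRepeats (suc (suc zero)) p _ end≤L closed _ =
        ⊥-elim (noBacktrack p (subst (_≤ L) (+-comm p 2) end≤L) (trans closed (cong w (+-comm p 2))))
      noRepeats (suc (suc (suc k))) p _ end≤L closed simple = simpleSegment⇒cycle k p end≤L closed simple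

module WalkReduction {A : Set} (R : A → A → Set) (_≟_ : DecidableEquality A) where

  Walk : A → A → Set
  Walk = PathIn R (λ _ → ⊤)

  NonBacktracking : ∀ {x y} → Walk x y → Set
  NonBacktracking (here _)                             = ⊤
  NonBacktracking (step _ _ (here _))                  = ⊤
  NonBacktracking (step {x} _ _ (step {_} {z} p r w)) = x ≢ z × NonBacktracking (step p r w)

  nonBacktracking-tail : ∀ {x y z} {p : ⊤} {r : R x y} (w : Walk y z)
                       → NonBacktracking (step p r w) → NonBacktracking w
  nonBacktracking-tail (here _)               _          = tt
  nonBacktracking-tail (step _ _ (here _))    _          = tt
  nonBacktracking-tail (step _ _ (step _ _ _)) (_ , nbt) = nbt

  -- Cancelling back-and-forth steps from the end yields a non-backtracking
  -- walk with the same endpoints, built from steps of the original walk.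
  reduce : ∀ {x y} → Walk x y → Σ (Walk x y) NonBacktracking
  reduce (here p) = here p , tt
  reduce (step {x} p r w) with reduce w
  ... | here q , _ = step p r (here q) , tt
  ... | step {_} {z} q r′ w′ , nbt with x ≟ z
  ...   | yes refl = w′ , nonBacktracking-tail w′ nbt
  ...   | no x≢z   = step p r (step q r′ w′) , x≢z , nbt

  vertexAt-nonBacktracking : ∀ {x y} (w : Walk x y) → NonBacktracking w
    → ∀ j → suc (suc j) ≤ steps w → vertexAt w j ≢ vertexAt w (suc (suc j))
  vertexAt-nonBacktracking (step _ _ (step _ _ (here _)))     (x≢z , _) zero _ = x≢z
  vertexAt-nonBacktracking (step _ _ (step _ _ (step _ _ _))) (x≢z , _) zero _ = x≢z
  vertexAt-nonBacktracking (step _ _ (here _)) _ zero (s≤s ())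
  vertexAt-nonBacktracking (step _ _ (step p r w)) (_ , nbt) (suc j) (s≤s j+2≤n) =
    vertexAt-nonBacktracking (step p r w) nbt j j+2≤n

detour⇒cycle : ∀ (T : Graph) {t u c} → Adj T t u
  → PathIn (Adj T) (_≢ u) t c → PathIn (Adj T) (_≢ t) u c → HasCycle T
detour⇒cycle T {t} {u} t~u t⇝c u⇝c =
  closedSegment⇒cycle (suc (steps W)) 0 (s≤s z≤n) ≤-refl (sym (vertexAt-last W))
  where
  Step : Fin (n T) → Fin (n T) → Set
  Step a b = Adj T a b × ¬ (a ≡ u × b ≡ t)

  open WalkReduction Step Fin._≟_

  u⇝t : Walk u t
  u⇝t = mapₚ (λ _ → tt) (λ _ b≢t a~b → a~b , λ e → b≢t (proj₂ e)) u⇝c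
     ++ₚ mapₚ (λ _ → tt) (λ a≢u _ a~b → a~b , λ e → a≢u (proj₁ e)) (reverseₚ (Graph.sym T) t⇝c)

  W : Walk u t
  W = proj₁ (reduce u⇝t)

  w : ℕ → Fin (n T)
  w zero    = t
  w (suc j) = vertexAt W j

  adjacent : ∀ j → j < suc (steps W) → Adj T (w j) (w (suc j))
  adjacent zero    _         = subst (Adj T t) (sym (vertexAt-first W)) t~u
  adjacent (suc j) (s≤s j<n) = proj₁ (vertexAt-step W j j<n)

  leavesU : ∀ {y} (V : Walk u y) → 1 ≤ steps V → t ≢ vertexAt V 1
  leavesU (step _ (_ , notBack) V) _ t≡ = notBack (refl , trans (sym (vertexAt-first V)) (sym t≡))

  noBacktrack : ∀ j → suc (suc j) ≤ suc (steps W) → w j ≢ w (suc (suc j))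
  noBacktrack zero    (s≤s 1≤n)   = leavesU W 1≤n
  noBacktrack (suc j) (s≤s j+2≤n) = vertexAt-nonBacktracking W (proj₂ (reduce u⇝t)) j j+2≤n

  open NonBacktracking T w (suc (steps W)) adjacent noBacktrack

-- A graph with a vertex and a map f sending each vertex to a neighbour, never
-- straight back (f (f t) ≢ t), has a cycle: the orbit of f is a
-- non-backtracking walk which, by pigeonhole, revisits a vertex.
successor⇒cycle : ∀ (T : Graph) (f : Fin (n T) → Fin (n T))
  → (∀ t → Adj T t (f t)) → (∀ t → f (f t) ≢ t) → Fin (n T) → HasCycle T
successor⇒cycle T f t~ft noReturn t₀ = cycleFrom (pigeonhole (n<1+n (n T)) (λ i → orbit (toℕ i)))
  where
  orbit : ℕ → Fin (n T)
  orbit zero    = t₀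
  orbit (suc k) = f (orbit k)

  open NonBacktracking T orbit (n T) (λ k _ → t~ft (orbit k)) (λ k _ e → noReturn (orbit k) (sym e))

  cycleFrom : ∃₂ (λ i j → toℕ i < toℕ j × orbit (toℕ i) ≡ orbit (toℕ j)) → HasCycle T
  cycleFrom (i , j , i<j , same) =
    closedSegment⇒cycle (toℕ j ∸ toℕ i) (toℕ i) (m<n⇒0<n∸m i<j)
      (subst (_≤ n T) (sym i+d≡j) (toℕ≤pred[n] j))
      (trans same (cong orbit (sym i+d≡j)))
    where
    i+d≡j : toℕ i + (toℕ j ∸ toℕ i) ≡ toℕ j
    i+d≡j = m+[n∸m]≡n (<⇒≤ i<j)

module Helly (T : Graph) (tree : IsTree T) {ℓ : ℕ} (S : Fin ℓ → Fin (n T) → Set)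
  (connected : ∀ i → Connected (Adj T) (S i))
  (meet : ∀ i j → ∃[ t ] (S i t × S j t)) where

  record Departure (t : Fin (n T)) : Set where
    field
      index   : Fin ℓ
      misses  : ¬ S index t
      next    : Fin (n T)
      edge    : Adj T t next
      target  : Fin (n T)
      reached : S index target
      route   : PathIn (Adj T) (_≢ t) next target
  open Departure

  avoid : ∀ {i t x y} → ¬ S i t → PathIn (Adj T) (S i) x y → PathIn (Adj T) (_≢ t) x y
  avoid {i} ¬Sit = mapₚ (λ Sia a≡t → ¬Sit (subst (S i) a≡t Sia)) (λ _ _ a~b → a~b)

  -- Leave t at the last visit of a walk from t to the (nonempty) subtree S i.
  depart : ∀ {t} i → ¬ S i t → Departure t
  depart {t} i ¬Sit with proj₁ (connected i)
  ... | s , Sis with lastDeparture Fin._≟_ t (proj₂ (proj₁ tree) t s tt tt)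
                                    (λ s≡t → ¬Sit (subst (S i) s≡t Sis))
  ...   | inj₁ avoiding          = ⊥-elim (headₚ avoiding refl)
  ...   | inj₂ (u , t~u , u⇝s) = record
    { index = i ; misses = ¬Sit ; next = u ; edge = t~u ; target = s ; reached = Sis ; route = u⇝s }

  -- Departing twice never leads straight back: otherwise the edge t u and the
  -- routes from u and t into two meeting subtrees would close up into a cycle.
  noReturn : ∀ {t} (d : Departure t) (d′ : Departure (next d)) → next d′ ≢ t
  noReturn {t} d d′ u′≡t = proj₂ tree (detour⇒cycle T (edge d) t⇝c u⇝c)
    where
    c = proj₁ (meet (index d) (index d′))

    u⇝c : PathIn (Adj T) (_≢ t) (next d) c
    u⇝c = route d ++ₚ avoid (misses d)
      (proj₂ (connected (index d)) (target d) c (reached d) (proj₁ (proj₂ (meet (index d) (index d′)))))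

    t⇝c : PathIn (Adj T) (_≢ next d) t c
    t⇝c = subst (λ z → PathIn (Adj T) (_≢ next d) z c) u′≡t (route d′ ++ₚ avoid (misses d′)
      (proj₂ (connected (index d′)) (target d′) c (reached d′) (proj₂ (proj₂ (meet (index d) (index d′))))))

  -- Pairwise meeting subtrees of a tree have a common vertex: otherwise every
  -- vertex has a departure, and following departures contradicts acyclicity.
  helly : (∀ i t → Dec (S i t)) → ∃[ t ] (∀ i → S i t)
  helly S? with any? (λ t → all? (λ i → S? i t))
  ... | yes common = common
  ... | no none    = ⊥-elim (proj₂ tree (successor⇒cycle T (next ∘ departure) (edge ∘ departure)
                              (λ t → noReturn (departure t) (departure (next (departure t))))
                              (proj₁ (proj₁ (proj₁ tree)))))
    where
    departure : ∀ t → Departure t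
    departure t with ¬∀⟶∃¬ ℓ (λ i → S i t) (λ i → S? i t) (λ all → none (t , all))
    ... | i , ¬Sit = depart i ¬Sit

module Fibres {A : Set} {k : ℕ} (h : A → Fin k) where

  fibreSize : Fin k → List A → ℕ
  fibreSize v [] = 0
  fibreSize v (x ∷ xs) with h x Fin.≟ v
  ... | yes _ = suc (fibreSize v xs)
  ... | no _  = fibreSize v xs

  outside : Fin k → List A → List A
  outside v [] = []
  outside v (x ∷ xs) with h x Fin.≟ v
  ... | yes _ = outside v xs
  ... | no _  = x ∷ outside v xs

  length-split : ∀ v xs → length xs ≡ fibreSize v xs + length (outside v xs)
  length-split v [] = refl
  length-split v (x ∷ xs) with h x Fin.≟ v
  ... | yes _ = cong suc (length-split v xs)
  ... | no _  = trans (cong suc (length-split v xs)) (sym (+-suc (fibreSize v xs) _))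

  fibreSize-∷ : ∀ w x xs → fibreSize w xs ≤ fibreSize w (x ∷ xs)
  fibreSize-∷ w x xs with h x Fin.≟ w
  ... | yes _ = n≤1+n _
  ... | no _  = ≤-refl

  fibreSize-outside : ∀ v w xs → fibreSize w (outside v xs) ≤ fibreSize w xs
  fibreSize-outside v w [] = z≤n
  fibreSize-outside v w (x ∷ xs) with h x Fin.≟ v
  ... | yes _ = ≤-trans (fibreSize-outside v w xs) (fibreSize-∷ w x xs)
  ... | no _ with h x Fin.≟ w
  ...   | yes _ = s≤s (fibreSize-outside v w xs)
  ...   | no _  = fibreSize-outside v w xs

  outside-images : ∀ {S : Subset k} v xs → All (λ x → h x ∈ S) xs → All (λ x → h x ∈ S ⊖ v) (outside v xs)
  outside-images v [] _ = []
  outside-images v (x ∷ xs) (hx∈S ∷ rest) with h x Fin.≟ v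
  ... | yes _   = outside-images v xs rest
  ... | no hx≢v = x∈p∧x≢y⇒x∈p-y hx∈S hx≢v ∷ outside-images v xs rest

  fibreSize-own : ∀ x xs → 1 ≤ fibreSize (h x) (x ∷ xs)
  fibreSize-own x xs with h x Fin.≟ h x
  ... | yes _   = s≤s z≤n
  ... | no hx≢hx = ⊥-elim (hx≢hx refl)

  -- A list with images in S and all fibres of size at most r has at most
  -- r · |S| entries: split off the fibre of the first entry and recurse
  -- (the recursion is on an upper bound of the length).
  bounded-fibres : ∀ r fuel (xs : List A) (S : Subset k) → length xs ≤ fuel
    → All (λ x → h x ∈ S) xs → (∀ v → fibreSize v xs ≤ r) → length xs ≤ r * ∣ S ∣
  bounded-fibres r fuel [] S _ _ _ = z≤n
  bounded-fibres r (suc fuel) (x ∷ xs) S len≤fuel (hx∈S ∷ images) small = begin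
      length (x ∷ xs)                  ≡⟨ length-split v (x ∷ xs) ⟩
      fibreSize v (x ∷ xs) + length ys ≤⟨ +-mono-≤ (small v) rest-bound ⟩
      r + r * ∣ S ⊖ v ∣                ≡⟨ sym (*-suc r _) ⟩
      r * suc ∣ S ⊖ v ∣                ≤⟨ *-monoʳ-≤ r (x∈p⇒∣p-x∣<∣p∣ hx∈S) ⟩
      r * ∣ S ∣                        ∎
    where
    open ≤-Reasoning
    v = h x
    ys = outside v (x ∷ xs)

    ys-shorter : length ys ≤ fuel
    ys-shorter = ≤-pred (≤-trans (≤-trans (+-monoˡ-≤ (length ys) (fibreSize-own x xs))
                   (≤-reflexive (sym (length-split v (x ∷ xs))))) len≤fuel)

    rest-bound : length ys ≤ r * ∣ S ⊖ v ∣
    rest-bound = bounded-fibres r fuel ys (S ⊖ v) ys-shorter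
      (outside-images v (x ∷ xs) (hx∈S ∷ images))
      (λ w → ≤-trans (fibreSize-outside v w (x ∷ xs)) (small w))

  fibre-injection : ∀ v (xs : List A) → Unique xs → ∀ m → m ≤ fibreSize v xs →
    Σ (Fin m → A) λ g → (∀ a → g a List.∈ xs) × Injective _≡_ _≡_ g × (∀ a → h (g a) ≡ v)
  fibre-injection v [] _ zero _ = (λ ()) , (λ ()) , (λ { {()} }) , λ ()
  fibre-injection v (x ∷ xs) (x∉xs ∷ unique) m m≤size with h x Fin.≟ v
  fibre-injection v (x ∷ xs) (x∉xs ∷ unique) m m≤size | no _ with fibre-injection v xs unique m m≤size
  ... | g , g∈xs , g-inj , g-fibre = g , there ∘ g∈xs , g-inj , g-fibre
  fibre-injection v (x ∷ xs) (x∉xs ∷ unique) zero _ | yes _ = (λ ()) , (λ ()) , (λ { {()} }) , λ ()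
  fibre-injection v (x ∷ xs) (x∉xs ∷ unique) (suc m) (s≤s m≤size) | yes hx≡v
    with fibre-injection v xs unique m m≤size
  ... | g , g∈xs , g-inj , g-fibre = g′ , g′∈ , g′-inj , g′-fibre
    where
    g′ : Fin (suc m) → A
    g′ zero    = x
    g′ (suc a) = g a

    g′∈ : ∀ a → g′ a List.∈ (x ∷ xs)
    g′∈ zero    = here refl
    g′∈ (suc a) = there (g∈xs a)

    g′-inj : Injective _≡_ _≡_ g′
    g′-inj {zero}  {zero}  _ = refl
    g′-inj {zero}  {suc b} e = ⊥-elim (All.lookup x∉xs (g∈xs b) e)
    g′-inj {suc a} {zero}  e = ⊥-elim (All.lookup x∉xs (g∈xs a) (sym e))
    g′-inj {suc a} {suc b} e = cong suc (g-inj e)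

    g′-fibre : ∀ a → h (g′ a) ≡ v
    g′-fibre zero    = hx≡v
    g′-fibre (suc a) = g-fibre a

fibreBound : ∀ {ℓ k} r (h : Fin ℓ → Fin k) (S : Subset k) → (∀ i → h i ∈ S)
  → (∀ v (g : Fin (suc r) → Fin ℓ) → Injective _≡_ _≡_ g → (∀ a → h (g a) ≡ v) → ⊥)
  → ℓ ≤ r * ∣ S ∣
fibreBound {ℓ} r h S h∈S noLargeFibre =
  subst (_≤ r * ∣ S ∣) (length-tabulate id)
    (bounded-fibres r (length (allFin ℓ)) (allFin ℓ) S ≤-refl (All.tabulate (λ {i} _ → h∈S i)) smallFibre)
  where
  open Fibres h

  smallFibre : ∀ v → fibreSize v (allFin ℓ) ≤ r
  smallFibre v with fibreSize v (allFin ℓ) ≤? r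
  ... | yes ≤r = ≤r
  ... | no ≰r with fibre-injection v (allFin ℓ) (allFin⁺ ℓ) (suc r) (≰⇒> ≰r)
  ...   | g , _ , g-inj , g-fibre = ⊥-elim (noLargeFibre v g g-inj g-fibre)

sharedVertex⇒clique : ∀ (G : Graph) {m} (X : Fin m → SubgraphData (n G)) {ℓ k}
  (B : Fin ℓ → Subset m) → (∀ i i′ → i ≢ i′ → ∀ j → j ∈ B i → j ∈ B i′ → ⊥)
  → (g : Fin k → Fin ℓ) → Injective _≡_ _≡_ g
  → (member : Fin k → Fin m) → (∀ a → member a ∈ B (g a))
  → (v : Fin (n G)) → (∀ a → v ∈ proj₁ (X (member a)))
  → HasCliqueSubgraph (IntersectionGraph G X) k
sharedVertex⇒clique G X B disjoint g g-inj member member∈B v v∈member =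
  member , member-inj , λ a b a≢b → (λ e → a≢b (member-inj e)) , v , v∈member a , v∈member b
  where
  member-inj : Injective _≡_ _≡_ member
  member-inj {a} {b} same with g a Fin.≟ g b
  ... | yes ga≡gb = g-inj ga≡gb
  ... | no ga≢gb  = ⊥-elim (disjoint (g a) (g b) ga≢gb (member a) (member∈B a)
                              (subst (_∈ B (g b)) (sym same) (member∈B b)))

module BranchSetBags (G : Graph) {m : ℕ} (X : Fin m → SubgraphData (n G))
  (X-connected : ∀ j → IsConnectedSubgraph G (X j))
  (T : Graph) (β : Fin (n T) → Subset (n G))
  (decomposition : IsTreeDecomposition G T β) where

  H : Graph
  H = IntersectionGraph G X

  tree : IsTree T
  tree = proj₁ decomposition

  covered : ∀ v → ∃[ t ] v ∈ β t
  covered = proj₁ (proj₂ decomposition)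

  record Meets (Y : Subset m) (t : Fin (n T)) : Set where
    constructor meeting
    field
      member   : Fin m
      member∈Y : member ∈ Y
      vertex   : Fin (n G)
      inMember : vertex ∈ proj₁ (X member)
      inBag    : vertex ∈ β t

  meets? : ∀ Y t → Dec (Meets Y t)
  meets? Y t = map′ (λ (j , j∈Y , v , v∈X , v∈β) → meeting j j∈Y v v∈X v∈β)
                    (λ (meeting j j∈Y v v∈X v∈β) → j , j∈Y , v , v∈X , v∈β)
                    (any? λ j → (j ∈? Y) ×-dec any? λ v → (v ∈? proj₁ (X j)) ×-dec (v ∈? β t))

  vertexBags : ∀ {Y j v t t′} → j ∈ Y → v ∈ proj₁ (X j) → v ∈ β t → v ∈ β t′
    → PathIn (Adj T) (Meets Y) t t′
  vertexBags {j = j} {v} {t} {t′} j∈Y v∈X v∈βt v∈βt′ =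
    mapₚ (meeting j j∈Y v v∈X) (λ _ _ r → r) (proj₂ (proj₂ (proj₂ (proj₂ decomposition)) v) t t′ v∈βt v∈βt′)

  -- Bags containing two vertices of one member are linked: follow a walk in
  -- the member, each of whose edges lies in some bag.
  memberBags : ∀ {Y j v v′ t t′} → j ∈ Y
    → PathIn (λ a b → b ∈ lookup (proj₂ (X j)) a) (_∈ proj₁ (X j)) v v′
    → v ∈ β t → v′ ∈ β t′ → PathIn (Adj T) (Meets Y) t t′
  memberBags j∈Y (here v∈X) v∈βt v′∈βt′ = vertexBags j∈Y v∈X v∈βt v′∈βt′
  memberBags {j = j} j∈Y (step {v} {w} v∈X vw rest) v∈βt v′∈βt′
    with proj₁ (proj₁ (X-connected j)) v w vw
  ... | v~w , _ with proj₁ (proj₂ (proj₂ decomposition)) v w v~w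
  ...   | s , v∈βs , w∈βs = vertexBags j∈Y v∈X v∈βt v∈βs ++ₚ memberBags j∈Y rest w∈βs v′∈βt′

  -- Bags meeting two members joined by a walk inside Y in H are linked:
  -- consecutive members share a vertex, which lies in some bag.
  unionBags : ∀ {Y j j′ v v′ t t′} → PathIn (Adj H) (_∈ Y) j j′
    → v ∈ proj₁ (X j) → v′ ∈ proj₁ (X j′) → v ∈ β t → v′ ∈ β t′ → PathIn (Adj T) (Meets Y) t t′
  unionBags {j = j} {v = v} {v′} (here j∈Y) v∈X v′∈X v∈βt v′∈βt′ =
    memberBags j∈Y (proj₂ (proj₂ (X-connected j)) v v′ v∈X v′∈X) v∈βt v′∈βt′
  unionBags {j = j} {v = v} (step j∈Y (_ , w , w∈X , w∈X′) rest) v∈X v′∈X v∈βt v′∈βt′ =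
    memberBags j∈Y (proj₂ (proj₂ (X-connected j)) v w v∈X w∈X) v∈βt (proj₂ (covered w))
    ++ₚ unionBags rest w∈X′ v′∈X (proj₂ (covered w)) v′∈βt′

  sharedBag : ∀ {Y Y′ j j′ v} → j ∈ Y → j′ ∈ Y′ → v ∈ proj₁ (X j) → v ∈ proj₁ (X j′)
    → ∃[ t ] (Meets Y t × Meets Y′ t)
  sharedBag {j = j} {j′} {v} j∈Y j′∈Y′ v∈X v∈X′ with covered v
  ... | t , v∈βt = t , meeting j j∈Y v v∈X v∈βt , meeting j′ j′∈Y′ v v∈X′ v∈βt

  occupied : ∀ {Y} → ∃[ j ] j ∈ Y → ∃[ j ] ∃[ v ] (j ∈ Y × v ∈ proj₁ (X j))
  occupied (j , j∈Y) = j , proj₁ (proj₁ (proj₂ (X-connected j))) , j∈Y , proj₂ (proj₁ (proj₂ (X-connected j)))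

  meets-connected : ∀ {Y} → Connected (Adj H) (_∈ Y) → Connected (Adj T) (Meets Y)
  meets-connected {Y} (nonempty , linked) = nonemptyBags , linkedBags
    where
    nonemptyBags : ∃[ t ] Meets Y t
    nonemptyBags with occupied nonempty
    ... | _ , _ , j∈Y , v∈X with sharedBag j∈Y j∈Y v∈X v∈X
    ...   | t , meetsY , _ = t , meetsY

    linkedBags : ∀ t t′ → Meets Y t → Meets Y t′ → PathIn (Adj T) (Meets Y) t t′
    linkedBags t t′ (meeting j j∈Y _ v∈X v∈βt) (meeting j′ j′∈Y _ v′∈X v′∈βt′) =
      unionBags (linked j j′ j∈Y j′∈Y) v∈X v′∈X v∈βt v′∈βt′

  commonBag : ∀ {ℓ} (model : HasCliqueMinor H ℓ) → ∃[ t ] (∀ i → Meets (proj₁ model i) t)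
  commonBag (B , B-connected , _ , B-touch) =
    Helly.helly T tree (λ i → Meets (B i)) (meets-connected ∘ B-connected) meet (meets? ∘ B)
    where
    meet : ∀ i i′ → ∃[ t ] (Meets (B i) t × Meets (B i′) t)
    meet i i′ with i Fin.≟ i′
    ... | yes refl with occupied (proj₁ (B-connected i))
    ...   | _ , _ , j∈B , v∈X = sharedBag j∈B j∈B v∈X v∈X
    meet i i′ | no i≢i′ with B-touch i i′ i≢i′
    ...   | _ , _ , j∈B , j′∈B′ , _ , v , v∈X , v∈X′ = sharedBag j∈B j′∈B′ v∈X v∈X′

-- ℓ ≤ r · N gives ⌈ℓ / r⌉ ≤ N, since ℓ + r - 1 < (N + 1) · r.
ceilDiv-bound : ∀ ℓ r (r≥1 : 1 ≤ r) N → ℓ ≤ r * N → (+ ceilDiv ℓ r r≥1) - 1ℤ ℤ.≤ (+ N) - 1ℤ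
ceilDiv-bound ℓ (suc r′) (s≤s z≤n) N ℓ≤rN = ℤ.+-monoˡ-≤ (ℤ.- 1ℤ) (ℤ.+≤+ ceil≤N)
  where
  numerator< : ℓ + suc r′ ∸ 1 < suc N * suc r′
  numerator< rewrite +-suc ℓ r′ = s≤s (begin
      ℓ + r′          ≤⟨ +-monoˡ-≤ r′ (≤-trans ℓ≤rN (≤-reflexive (*-comm (suc r′) N))) ⟩
      N * suc r′ + r′ ≡⟨ +-comm (N * suc r′) r′ ⟩
      r′ + N * suc r′ ∎)
    where open ≤-Reasoning

  ceil≤N : ceilDiv ℓ (suc r′) (s≤s z≤n) ≤ N
  ceil≤N = ≤-pred (m<n*o⇒m/o<n {n = suc N} numerator<)

lemma8 : (r : ℕ) (r≥1 : 1 ≤ r) (G : Graph) (m : ℕ) (X : Fin m → SubgraphData (n G))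
    → Injective _≡_ _≡_ X
    → (∀ i → IsConnectedSubgraph G (X i))
    → (ℓ : ℕ)
    → HasCliqueMinor (IntersectionGraph G X) ℓ
    → ¬ HasCliqueSubgraph (IntersectionGraph G X) (suc r)
    → TreewidthAtLeast G ((+ ceilDiv ℓ r r≥1) - 1ℤ)
lemma8 r r≥1 G m X _ X-connected ℓ model@(B , _ , disjoint , _) noClique T β decomposition =
  x , ceilDiv-bound ℓ r r≥1 ∣ β x ∣ (fibreBound r vertexOf (β x) (inBag ∘ meets) smallFibres)
  where
  open BranchSetBags G X X-connected T β decomposition
  open Meets

  x = proj₁ (commonBag model)
  meets : ∀ i → Meets (B i) x
  meets = proj₂ (commonBag model)

  vertexOf : Fin ℓ → Fin (n G)
  vertexOf i = vertex (meets i)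

  smallFibres : ∀ v (g : Fin (suc r) → Fin ℓ) → Injective _≡_ _≡_ g → (∀ a → vertexOf (g a) ≡ v) → ⊥
  smallFibres v g g-inj sameVertex = noClique (sharedVertex⇒clique G X B disjoint g g-inj
    (member ∘ meets ∘ g) (member∈Y ∘ meets ∘ g)
    v (λ a → subst (_∈ proj₁ (X (member (meets (g a))))) (sameVertex a) (inMember (meets (g a)))))
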